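{- (Completeness) For any set $\Gamma\cup\{\phi\}$ of $\mathbf{PL}(\text{⩔})$-formulas, $\Gamma\models\phi$ iff $\Gamma\vdash\phi$ in the natural deduction system for $\mathbf{PL}(\text{⩔})$ described below.
   Context: Classical formulas: $\alpha::=p\mid\bot\mid\neg\alpha\mid\alpha\wedge\alpha\mid\alpha\vee\alpha$. $\mathbf{PL}(\text{⩔})$-formulas: $\phi::=p\mid\bot\mid\neg\phi\mid\phi\wedge\phi\mid\phi\vee\phi\mid\phi\,\text{⩔}\,\phi$ (negation may apply to arbitrary formulas). A team is a set of valuations $v$ (maps from propositional variables to $\{0,1\}$). Team semantics: $t\models p$ iff $v(p)=1$ for all $v\in t$; $t\models\bot$ iff $t=\emptyset$; $t\models\neg\phi$ iff $\{v\}\not\models\phi$ for all $v\in t$; $t\models\phi\wedge\psi$ iff both hold; $t\models\phi\vee\psi$ iff $t=r\cup s$ for some $r,s\subseteq t$ with $r\models\phi$, $s\models\psi$; $t\models\phi\,\text{⩔}\,\psi$ iff $t\models\phi$ or $t\models\psi$. $\Gamma\models\phi$ iff every team satisfying all formulas of $\Gamma$ satisfies $\phi$. The natural deduction system (with $\phi,\psi,\chi$ arbitrary and $\alpha$ ranging over classical formulas only; $[\cdot]$ marks discharged assumptions) has rules: $\bot$E: from $\bot$ infer $\phi$. $\wedge$I: from $\phi,\psi$ infer $\phi\wedge\psi$; $\wedge$E: from $\phi\wedge\psi$ infer $\phi$, and infer $\psi$. $\neg$I: from a derivation of $\bot$ from $[\phi]$ infer $\neg\phi$; $\neg$E: from $\phi$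 and $\neg\phi$ infer $\psi$; RAA: from a derivation of $\bot$ from $[\neg\alpha]$ infer $\alpha$. ⩔I: from $\phi$ infer $\phi\,\text{⩔}\,\psi$ and $\psi\,\text{⩔}\,\phi$; ⩔E: from $\phi\,\text{⩔}\,\psi$, a derivation of $\chi$ from $[\phi]$ and one from $[\psi]$, infer $\chi$. $\vee$I: from $\phi$ infer $\phi\vee\psi$; $\vee$E: from $\phi\vee\psi$, a derivation of $\alpha$ from $[\phi]$ and one from $[\psi]$, infer $\alpha$; $\vee$Com: from $\phi\vee\psi$ infer $\psi\vee\phi$; $\vee$Mon: from $\phi\vee\psi$ and a derivation of $\chi$ from $[\phi]$, infer $\chi\vee\psi$. Dis$\vee$⩔: from $\phi\vee(\psi\,\text{⩔}\,\chi)$ infer $(\phi\vee\psi)\,\text{⩔}\,(\phi\vee\chi)$. $\Gamma\vdash\phi$ means $\phi$ is derivable from assumptions in $\Gamma$. -}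

module Defs where

open import Data.Nat using (ℕ)
open import Data.Bool using (Bool; true)
open import Data.Empty using (⊥)
open import Data.Sum using (_⊎_)
open import Data.Product using (_×_; Σ; ∃)
open import Relation.Nullary using (¬_)
open import Level using (Lift)
open import Relation.Binary.PropositionalEquality using (_≡_)

Var : Set
Var = ℕ

infixr 6 _∧'_
infixr 5 _∨'_
infixr 4 _⩔_
data Form : Set where
  var  : Var → Form
  ⊥'   : Form
  ¬'_  : Form → Form
  _∧'_ : Form → Form → Form
  _∨'_ : Form → Form → Form
  _⩔_  : Form → Form → Form

data Classical : Form → Set where
  var  : ∀ p → Classical (var p)
  ⊥'   : Classical ⊥'
  ¬'_  : ∀ {α} → Classical α → Classical (¬' α)
  _∧'_ : ∀ {α β} → Classical α → Classical β → Classical (α ∧' β)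
  _∨'_ : ∀ {α β} → Classical α → Classical β → Classical (α ∨' β)

Valuation : Set
Valuation = Var → Bool

Team : Set₁
Team = Valuation → Set

singleton : Valuation → Team
singleton v w = ∀ n → w n ≡ v n

_⊆_ : Team → Team → Set
r ⊆ t = ∀ v → r v → t v

IsUnion : Team → Team → Team → Set
IsUnion t r s = ∀ v → (t v → r v ⊎ s v) × (r v ⊎ s v → t v)

infix 3 _⊨_
_⊨_ : Team → Form → Set₁
t ⊨ var p   = Lift _ (∀ v → t v → v p ≡ true)
t ⊨ ⊥'      = Lift _ (∀ v → ¬ t v)
t ⊨ ¬' φ    = ∀ v → t v → ¬ (singleton v ⊨ φ)
t ⊨ φ ∧' ψ  = (t ⊨ φ) × (t ⊨ ψ)
t ⊨ φ ∨' ψ  = Σ Team λ r → Σ Team λ s →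
                 (r ⊆ t) × (s ⊆ t) × IsUnion t r s × (r ⊨ φ) × (s ⊨ ψ)
t ⊨ φ ⩔ ψ   = (t ⊨ φ) ⊎ (t ⊨ ψ)

Ctx : Set₁
Ctx = Form → Set

_,,_ : Ctx → Form → Ctx
(Γ ,, φ) ψ = Γ ψ ⊎ ψ ≡ φ

infix 3 _⊨ᶜ_
_⊨ᶜ_ : Ctx → Form → Set₁
Γ ⊨ᶜ φ = ∀ (t : Team) → (∀ ψ → Γ ψ → t ⊨ ψ) → t ⊨ φ

infix 3 _⊢_
data _⊢_ : Ctx → Form → Set₁ where
  assm : ∀ {Γ φ} → Γ φ → Γ ⊢ φ
  ⊥E   : ∀ {Γ φ} → Γ ⊢ ⊥' → Γ ⊢ φ
  ∧I   : ∀ {Γ φ ψ} → Γ ⊢ φ → Γ ⊢ ψ → Γ ⊢ φ ∧' ψ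
  ∧E₁  : ∀ {Γ φ ψ} → Γ ⊢ φ ∧' ψ → Γ ⊢ φ
  ∧E₂  : ∀ {Γ φ ψ} → Γ ⊢ φ ∧' ψ → Γ ⊢ ψ
  ¬I   : ∀ {Γ φ} → (Γ ,, φ) ⊢ ⊥' → Γ ⊢ ¬' φ
  ¬E   : ∀ {Γ φ ψ} → Γ ⊢ φ → Γ ⊢ ¬' φ → Γ ⊢ ψ
  RAA  : ∀ {Γ α} → Classical α → (Γ ,, (¬' α)) ⊢ ⊥' → Γ ⊢ α
  ⩔I₁  : ∀ {Γ φ ψ} → Γ ⊢ φ → Γ ⊢ φ ⩔ ψ
  ⩔I₂  : ∀ {Γ φ ψ} → Γ ⊢ φ → Γ ⊢ ψ ⩔ φ
  ⩔E   : ∀ {Γ φ ψ χ} → Γ ⊢ φ ⩔ ψ → (Γ ,, φ) ⊢ χ → (Γ ,, ψ) ⊢ χ → Γ ⊢ χ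
  ∨I   : ∀ {Γ φ ψ} → Γ ⊢ φ → Γ ⊢ φ ∨' ψ
  ∨E   : ∀ {Γ φ ψ α} → Classical α →
           Γ ⊢ φ ∨' ψ → (Γ ,, φ) ⊢ α → (Γ ,, ψ) ⊢ α → Γ ⊢ α
  ∨Com : ∀ {Γ φ ψ} → Γ ⊢ φ ∨' ψ → Γ ⊢ ψ ∨' φ
  ∨Mon : ∀ {Γ φ ψ χ} → Γ ⊢ φ ∨' ψ → (Γ ,, φ) ⊢ χ → Γ ⊢ χ ∨' ψ
  Dis∨⩔ : ∀ {Γ φ ψ χ} → Γ ⊢ φ ∨' (ψ ⩔ χ) → Γ ⊢ (φ ∨' ψ) ⩔ (φ ∨' χ)

-- Every formula φ is provably equivalent to the ⩔-disjunction ⋁ (nf φ) of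
-- classical formulas: Dis∨⩔ pushes ⩔ outwards, and under ¬ the connective ⩔
-- may be replaced by ∨. Classical formulas are flat, so if χ ⊨ φ then every
-- disjunct α of nf χ classically entails some disjunct β of nf φ, and then
-- α ⊢ β by Kalmár's lemma, RAA discharging the literal hypotheses one variable
-- at a time. This gives completeness for a single premise, hence for finite Γ.
--
-- For arbitrary Γ it remains to prove compactness. A team satisfying Γ but not φ
-- contains, for each of the m disjuncts of nf φ, a valuation falsifying it, and
-- these m valuations already form such a team, by downward closure. Teams of m
-- valuations are points of (Bool^m)^ℕ, where satisfaction of a formula depends
-- on finitely many coordinates, so compactness of that space (König's lemma,
-- using excluded middle) yields a counter-team for Γ from counter-teams for
-- its finite subsets.

module Submission where

open import Defs
import Level
open import Level using (0ℓ; lift; lower)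
open import Axiom.ExcludedMiddle using (ExcludedMiddle)
open import Axiom.DoubleNegationElimination using (DoubleNegationElimination; em⇒dne)
open import Data.Bool using (Bool; true; false; not; _∧_; _∨_; if_then_else_; T)
open import Data.Bool.Properties using (T-≡; T-∧; T-∨)
open import Data.Empty using (⊥; ⊥-elim)
open import Data.Fin using (Fin)
open import Data.List using (List; []; _∷_; _++_; length; lookup; cartesianProductWith; concatMap)
open import Data.List.Membership.Propositional using (_∈_)
open import Data.List.Membership.Propositional.Properties
  using (∈-map⁺; ∈-concat⁺′; ∈-lookup; ∈-++⁺ˡ; ∈-++⁺ʳ; ∈-++⁻; ∈-cartesianProductWith⁺; ∈-cartesianProductWith⁻)
open import Data.List.Relation.Unary.All as All using (All; []; _∷_)
open import Data.List.Relation.Unary.Any using (here; there; index)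
open import Data.List.Relation.Unary.Any.Properties using (lookup-index)
open import Data.Maybe using (Maybe; just; nothing)
open import Data.Nat using (ℕ; zero; suc; _<_; _≤_; _⊔_; _≟_)
open import Data.Nat.Properties
  using (≤-refl; <⇒≢; m⊔n≤o⇒m≤o; m⊔n≤o⇒n≤o; m≤m⊔n; m≤n⊔m; m<1+n⇒m<n∨m≡n)
open import Data.Product using (_×_; _,_; proj₁; proj₂; Σ; ∃)
open import Data.Sum as Sum using (inj₁; inj₂; [_,_]′; map₁; swap)
open import Data.Vec as Vec using (Vec; []; _∷_; tabulate)
open import Data.Vec.Properties using (lookup∘tabulate)
open import Function using (_∘_; id; _⇔_; mk⇔; Equivalence)
open import Relation.Binary.PropositionalEquality using (_≡_; refl; sym; trans; cong; cong₂; subst)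
open import Relation.Nullary using (¬_; yes; no)
open import Relation.Unary using (_∪_) renaming (_⊆_ to _⊆ᶜ_)

module _ {A : Set} where

  infix 4 _≈[_]_
  _≈[_]_ : (ℕ → A) → ℕ → (ℕ → A) → Set
  f ≈[ N ] g = ∀ n → n < N → f n ≡ g n

  ≈-sym : ∀ {f g N} → f ≈[ N ] g → g ≈[ N ] f
  ≈-sym f≈g n n<N = sym (f≈g n n<N)

  ≈-trans : ∀ {f g h N} → f ≈[ N ] g → g ≈[ N ] h → f ≈[ N ] h
  ≈-trans f≈g g≈h n n<N = trans (f≈g n n<N) (g≈h n n<N)

  _[_≔_] : (ℕ → A) → ℕ → A → ℕ → A
  (f [ N ≔ a ]) n with n ≟ N
  ... | yes _ = a
  ... | no  _ = f n

  [≔]-same : ∀ f N (a : A) → (f [ N ≔ a ]) N ≡ a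
  [≔]-same f N a with N ≟ N
  ... | yes _ = refl
  ... | no N≢N = ⊥-elim (N≢N refl)

  [≔]-≈ : ∀ f N (a : A) → f [ N ≔ a ] ≈[ N ] f
  [≔]-≈ f N a n n<N with n ≟ N
  ... | yes n≡N = ⊥-elim (<⇒≢ n<N n≡N)
  ... | no  _   = refl

  ≈-[≔] : ∀ {f g N} → g ≈[ N ] f → g ≈[ suc N ] f [ N ≔ g N ]
  ≈-[≔] {f} {g} {N} g≈f n n<1+N with m<1+n⇒m<n∨m≡n n<1+N
  ... | inj₁ n<N  = trans (g≈f n n<N) (sym ([≔]-≈ f N (g N) n n<N))
  ... | inj₂ refl = sym ([≔]-same f N (g N))

weaken : ∀ {Γ Δ φ} → Γ ⊆ᶜ Δ → Γ ⊢ φ → Δ ⊢ φ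
weaken s (assm x) = assm (s x)
weaken s (⊥E d) = ⊥E (weaken s d)
weaken s (∧I d e) = ∧I (weaken s d) (weaken s e)
weaken s (∧E₁ d) = ∧E₁ (weaken s d)
weaken s (∧E₂ d) = ∧E₂ (weaken s d)
weaken s (¬I d) = ¬I (weaken (map₁ s) d)
weaken s (¬E d e) = ¬E (weaken s d) (weaken s e)
weaken s (RAA c d) = RAA c (weaken (map₁ s) d)
weaken s (⩔I₁ d) = ⩔I₁ (weaken s d)
weaken s (⩔I₂ d) = ⩔I₂ (weaken s d)
weaken s (⩔E d e f) = ⩔E (weaken s d) (weaken (map₁ s) e) (weaken (map₁ s) f)
weaken s (∨I d) = ∨I (weaken s d)
weaken s (∨E c d e f) = ∨E c (weaken s d) (weaken (map₁ s) e) (weaken (map₁ s) f)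
weaken s (∨Com d) = ∨Com (weaken s d)
weaken s (∨Mon d e) = ∨Mon (weaken s d) (weaken (map₁ s) e)
weaken s (Dis∨⩔ d) = Dis∨⩔ (weaken s d)

weaken₁ : ∀ {Γ φ ψ} → Γ ⊢ φ → (Γ ,, ψ) ⊢ φ
weaken₁ = weaken inj₁

weaken-under : ∀ {Γ φ ψ χ} → (Γ ,, ψ) ⊢ φ → ((Γ ,, χ) ,, ψ) ⊢ φ
weaken-under = weaken (map₁ inj₁)

exchange : ∀ {Γ φ ψ χ} → ((Γ ,, ψ) ,, χ) ⊢ φ → ((Γ ,, χ) ,, ψ) ⊢ φ
exchange = weaken [ [ inj₁ ∘ inj₁ , inj₂ ]′ , inj₁ ∘ inj₂ ]′

hyp : ∀ {Γ φ} → (Γ ,, φ) ⊢ φ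
hyp = assm (inj₂ refl)

cut : ∀ {Γ ψ χ} → Γ ⊢ ψ → (Γ ,, ψ) ⊢ χ → Γ ⊢ χ
cut d e = ⩔E (⩔I₁ d) e e

RAAable : Form → Set₁
RAAable β = ∀ {Δ} → (Δ ,, (¬' β)) ⊢ ⊥' → Δ ⊢ β

¬-RAAable : ∀ φ → RAAable (¬' φ)
¬-RAAable φ d = ¬I (cut (¬I (¬E (weaken₁ hyp) hyp)) (weaken-under d))

by-cases : ∀ {Δ β} p → RAAable β → (Δ ,, p) ⊢ β → (Δ ,, (¬' p)) ⊢ β → Δ ⊢ β
by-cases p raa d₁ d₂ =
  raa (¬E (¬I (¬E (exchange (weaken₁ d₁)) (weaken₁ hyp)))
          (¬I (¬E (exchange (weaken₁ d₂)) (weaken₁ hyp))))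

-- Kalmár's lemma

eval : Valuation → Form → Bool
eval v (var p)  = v p
eval v ⊥'       = false
eval v (¬' φ)   = not (eval v φ)
eval v (φ ∧' ψ) = eval v φ ∧ eval v ψ
eval v (φ ∨' ψ) = eval v φ ∨ eval v ψ
eval v (φ ⩔ ψ)  = eval v φ ∨ eval v ψ

varBound : Form → ℕ
varBound (var p)  = suc p
varBound ⊥'       = 0
varBound (¬' φ)   = varBound φ
varBound (φ ∧' ψ) = varBound φ ⊔ varBound ψ
varBound (φ ∨' ψ) = varBound φ ⊔ varBound ψ
varBound (φ ⩔ ψ)  = varBound φ ⊔ varBound ψ

signed : Valuation → Form → Form
signed v φ = if eval v φ then φ else ¬' φ

literal : Bool → Var → Form
literal b p = if b then var p else ¬' var p

Literals : Valuation → ℕ → Ctx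
Literals v N ψ = ∃ λ n → n < N × ψ ≡ literal (v n) n

kalmar : ∀ {Δ v N} φ → varBound φ ≤ N → Literals v N ⊆ᶜ Δ → Δ ⊢ signed v φ
kalmar (var p) p<N lits = assm (lits (p , p<N , refl))
kalmar ⊥' _ _ = ¬I hyp
kalmar {v = v} (¬' φ) b lits with eval v φ | kalmar φ b lits
... | true  | d = ¬I (¬E (weaken₁ d) hyp)
... | false | d = d
kalmar {v = v} (φ ∧' ψ) b lits
  with eval v φ | kalmar φ (m⊔n≤o⇒m≤o _ _ b) lits | eval v ψ | kalmar ψ (m⊔n≤o⇒n≤o _ _ b) lits
... | true  | dφ | true  | dψ = ∧I dφ dψ
... | true  | _  | false | dψ = ¬I (¬E (∧E₂ hyp) (weaken₁ dψ))
... | false | dφ | _     | _  = ¬I (¬E (∧E₁ hyp) (weaken₁ dφ))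
kalmar {v = v} (φ ∨' ψ) b lits
  with eval v φ | kalmar φ (m⊔n≤o⇒m≤o _ _ b) lits | eval v ψ | kalmar ψ (m⊔n≤o⇒n≤o _ _ b) lits
... | true  | dφ | _     | _  = ∨I dφ
... | false | _  | true  | dψ = ∨Com (∨I dψ)
... | false | dφ | false | dψ =
  ¬I (∨E ⊥' hyp (¬E hyp (weaken₁ (weaken₁ dφ))) (¬E hyp (weaken₁ (weaken₁ dψ))))
kalmar {v = v} (φ ⩔ ψ) b lits
  with eval v φ | kalmar φ (m⊔n≤o⇒m≤o _ _ b) lits | eval v ψ | kalmar ψ (m⊔n≤o⇒n≤o _ _ b) lits
... | true  | dφ | _     | _  = ⩔I₁ dφ
... | false | _  | true  | dψ = ⩔I₂ dψ
... | false | dφ | false | dψ =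
  ¬I (⩔E hyp (¬E hyp (weaken₁ (weaken₁ dφ))) (¬E hyp (weaken₁ (weaken₁ dψ))))

Literals-≈ : ∀ {w v N} → w ≈[ N ] v → Literals w N ⊆ᶜ Literals v N
Literals-≈ w≈v (n , n<N , refl) = n , n<N , cong (λ b → literal b n) (w≈v n n<N)

Literals-suc : ∀ {v N} → Literals v (suc N) ⊆ᶜ (Literals v N ,, literal (v N) N)
Literals-suc (n , n<1+N , refl) with m<1+n⇒m<n∨m≡n n<1+N
... | inj₁ n<N  = inj₁ (n , n<N , refl)
... | inj₂ refl = inj₂ refl

eliminate-literals : ∀ {Δ β} N → RAAable β → (∀ v → (Δ ∪ Literals v N) ⊢ β) → Δ ⊢ β
eliminate-literals zero _ d = weaken [ id , (λ { (_ , () , _) }) ]′ (d (λ _ → true))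
eliminate-literals {Δ} {β} (suc N) raa d = eliminate-literals N raa λ v →
  by-cases (var N) raa (assuming v true) (assuming v false)
  where
  assuming : ∀ v b → ((Δ ∪ Literals v N) ,, literal b N) ⊢ β
  assuming v b = subst (λ ψ → ((Δ ∪ Literals v N) ,, ψ) ⊢ β) (cong (λ b′ → literal b′ N) ([≔]-same v N b))
                  (weaken [ inj₁ ∘ inj₁ , [ inj₁ ∘ inj₂ ∘ Literals-≈ ([≔]-≈ v N b) , inj₂ ]′ ∘ Literals-suc ]′
                          (d (v [ N ≔ b ])))

⊢-tautological : ∀ {Γ α β} → RAAable β → (∀ v → T (eval v α) → T (eval v β)) → Γ ⊢ α → Γ ⊢ β
⊢-tautological {Γ} {α} {β} raa taut d = eliminate-literals N raa decide
  where
  N = varBound α ⊔ varBound β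
  decide : ∀ v → (Γ ∪ Literals v N) ⊢ β
  decide v with eval v α | eval v β | taut v
              | kalmar {Γ ∪ Literals v N} α (m≤m⊔n _ _) inj₂ | kalmar {Γ ∪ Literals v N} β (m≤n⊔m _ _) inj₂
  ... | _     | true  | _ | _  | dβ = dβ
  ... | false | false | _ | d¬α | _ = ¬E (weaken inj₁ d) d¬α
  ... | true  | false | f | _  | _ = ⊥-elim (f _)

-- Normal forms

toClassical : Form → Form
toClassical (var p)  = var p
toClassical ⊥'       = ⊥'
toClassical (¬' φ)   = ¬' toClassical φ
toClassical (φ ∧' ψ) = toClassical φ ∧' toClassical ψ
toClassical (φ ∨' ψ) = toClassical φ ∨' toClassical ψ
toClassical (φ ⩔ ψ)  = toClassical φ ∨' toClassical ψ

toClassical-classical : ∀ φ → Classical (toClassical φ)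
toClassical-classical (var p)  = var p
toClassical-classical ⊥'       = ⊥'
toClassical-classical (¬' φ)   = ¬' toClassical-classical φ
toClassical-classical (φ ∧' ψ) = toClassical-classical φ ∧' toClassical-classical ψ
toClassical-classical (φ ∨' ψ) = toClassical-classical φ ∨' toClassical-classical ψ
toClassical-classical (φ ⩔ ψ)  = toClassical-classical φ ∨' toClassical-classical ψ

eval-toClassical : ∀ v φ → eval v (toClassical φ) ≡ eval v φ
eval-toClassical v (var p)  = refl
eval-toClassical v ⊥'       = refl
eval-toClassical v (¬' φ)   = cong not (eval-toClassical v φ)
eval-toClassical v (φ ∧' ψ) = cong₂ _∧_ (eval-toClassical v φ) (eval-toClassical v ψ)
eval-toClassical v (φ ∨' ψ) = cong₂ _∨_ (eval-toClassical v φ) (eval-toClassical v ψ)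
eval-toClassical v (φ ⩔ ψ)  = cong₂ _∨_ (eval-toClassical v φ) (eval-toClassical v ψ)

¬-toClassical : ∀ {Γ} φ → Γ ⊢ ¬' φ → Γ ⊢ ¬' toClassical φ
¬-toClassical φ = ⊢-tautological (¬-RAAable _)
  (λ v → subst (T ∘ not) (sym (eval-toClassical v φ)))

¬-fromClassical : ∀ {Γ} φ → Γ ⊢ ¬' toClassical φ → Γ ⊢ ¬' φ
¬-fromClassical φ = ⊢-tautological (¬-RAAable _)
  (λ v → subst (T ∘ not) (eval-toClassical v φ))

⋁ : List Form → Form
⋁ []           = ⊥'
⋁ (α ∷ [])     = α
⋁ (α ∷ β ∷ αs) = α ⩔ ⋁ (β ∷ αs)

⋁-intro : ∀ {Γ α} αs → α ∈ αs → Γ ⊢ α → Γ ⊢ ⋁ αs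
⋁-intro (_ ∷ [])     (here refl) d = d
⋁-intro (_ ∷ _ ∷ _)  (here refl) d = ⩔I₁ d
⋁-intro (_ ∷ β ∷ αs) (there α∈) d = ⩔I₂ (⋁-intro (β ∷ αs) α∈ d)

⋁-elim : ∀ {Γ χ} αs → Γ ⊢ ⋁ αs → (∀ {α} → α ∈ αs → (Γ ,, α) ⊢ χ) → Γ ⊢ χ
⋁-elim []           d _ = ⊥E d
⋁-elim (_ ∷ [])     d k = cut d (k (here refl))
⋁-elim (_ ∷ β ∷ αs) d k =
  ⩔E d (k (here refl)) (⋁-elim (β ∷ αs) hyp (weaken-under ∘ k ∘ there))

NonEmpty : List Form → Set
NonEmpty αs = ∃ λ α → α ∈ αs

-- Non-emptiness matters: ⋁ [] = ⊥', whereas ⊥' ∨' δ is equivalent to δ.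
⋁∨-elim : ∀ {Γ χ δ} αs → NonEmpty αs → Γ ⊢ ⋁ αs ∨' δ →
          (∀ {α} → α ∈ αs → (Γ ,, (α ∨' δ)) ⊢ χ) → Γ ⊢ χ
⋁∨-elim []           (_ , ()) _ _
⋁∨-elim (_ ∷ [])     _ d k = cut d (k (here refl))
⋁∨-elim (_ ∷ β ∷ αs) _ d k =
  ⩔E (Dis∨⩔ (∨Com d))
     (cut (∨Com hyp) (weaken-under (k (here refl))))
     (⋁∨-elim (β ∷ αs) (β , here refl) (∨Com hyp) (weaken-under ∘ k ∘ there))

nf : Form → List Form
nf (var p)  = var p ∷ []
nf ⊥'       = ⊥' ∷ []
nf (¬' φ)   = ¬' toClassical φ ∷ []
nf (φ ∧' ψ) = cartesianProductWith _∧'_ (nf φ) (nf ψ)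
nf (φ ∨' ψ) = cartesianProductWith _∨'_ (nf φ) (nf ψ)
nf (φ ⩔ ψ)  = nf φ ++ nf ψ

nf-classical : ∀ φ {α} → α ∈ nf φ → Classical α
nf-classical (var p) (here refl) = var p
nf-classical ⊥'      (here refl) = ⊥'
nf-classical (¬' φ)  (here refl) = ¬' toClassical-classical φ
nf-classical (φ ∧' ψ) α∈ with ∈-cartesianProductWith⁻ _∧'_ (nf φ) (nf ψ) α∈
... | _ , _ , β∈ , γ∈ , refl = nf-classical φ β∈ ∧' nf-classical ψ γ∈
nf-classical (φ ∨' ψ) α∈ with ∈-cartesianProductWith⁻ _∨'_ (nf φ) (nf ψ) α∈
... | _ , _ , β∈ , γ∈ , refl = nf-classical φ β∈ ∨' nf-classical ψ γ∈
nf-classical (φ ⩔ ψ) α∈ with ∈-++⁻ (nf φ) α∈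
... | inj₁ β∈ = nf-classical φ β∈
... | inj₂ γ∈ = nf-classical ψ γ∈

nf-nonEmpty : ∀ φ → NonEmpty (nf φ)
nf-nonEmpty (var p)  = _ , here refl
nf-nonEmpty ⊥'       = _ , here refl
nf-nonEmpty (¬' φ)   = _ , here refl
nf-nonEmpty (φ ∧' ψ) = _ , ∈-cartesianProductWith⁺ _∧'_ (proj₂ (nf-nonEmpty φ)) (proj₂ (nf-nonEmpty ψ))
nf-nonEmpty (φ ∨' ψ) = _ , ∈-cartesianProductWith⁺ _∨'_ (proj₂ (nf-nonEmpty φ)) (proj₂ (nf-nonEmpty ψ))
nf-nonEmpty (φ ⩔ ψ)  = _ , ∈-++⁺ˡ (proj₂ (nf-nonEmpty φ))

⊢⋁nf : ∀ {Γ} φ → Γ ⊢ φ → Γ ⊢ ⋁ (nf φ)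
⊢⋁nf (var p)  d = d
⊢⋁nf ⊥'       d = d
⊢⋁nf (¬' φ)   d = ¬-toClassical φ d
⊢⋁nf (φ ∧' ψ) d =
  ⋁-elim (nf φ) (⊢⋁nf φ (∧E₁ d)) λ β∈ →
  ⋁-elim (nf ψ) (⊢⋁nf ψ (∧E₂ (weaken₁ d))) λ γ∈ →
  ⋁-intro (nf (φ ∧' ψ)) (∈-cartesianProductWith⁺ _∧'_ β∈ γ∈) (∧I (weaken₁ hyp) hyp)
⊢⋁nf (φ ∨' ψ) d =
  ⋁∨-elim (nf φ) (nf-nonEmpty φ) (∨Mon d (⊢⋁nf φ hyp)) λ β∈ →
  ⋁∨-elim (nf ψ) (nf-nonEmpty ψ) (∨Mon (∨Com hyp) (⊢⋁nf ψ hyp)) λ γ∈ →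
  ⋁-intro (nf (φ ∨' ψ)) (∈-cartesianProductWith⁺ _∨'_ β∈ γ∈) (∨Com hyp)
⊢⋁nf (φ ⩔ ψ)  d = ⩔E d
  (⋁-elim (nf φ) (⊢⋁nf φ hyp) λ β∈ → ⋁-intro (nf φ ++ nf ψ) (∈-++⁺ˡ β∈) hyp)
  (⋁-elim (nf ψ) (⊢⋁nf ψ hyp) λ γ∈ → ⋁-intro (nf φ ++ nf ψ) (∈-++⁺ʳ (nf φ) γ∈) hyp)

nf⊢ : ∀ {Γ α} φ → α ∈ nf φ → Γ ⊢ α → Γ ⊢ φ
nf⊢ (var p) (here refl) d = d
nf⊢ ⊥'      (here refl) d = d
nf⊢ (¬' φ)  (here refl) d = ¬-fromClassical φ d
nf⊢ (φ ∧' ψ) α∈ d with ∈-cartesianProductWith⁻ _∧'_ (nf φ) (nf ψ) α∈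
... | _ , _ , β∈ , γ∈ , refl = ∧I (nf⊢ φ β∈ (∧E₁ d)) (nf⊢ ψ γ∈ (∧E₂ d))
nf⊢ (φ ∨' ψ) α∈ d with ∈-cartesianProductWith⁻ _∨'_ (nf φ) (nf ψ) α∈
... | _ , _ , β∈ , γ∈ , refl = ∨Com (∨Mon (∨Com (∨Mon d (nf⊢ φ β∈ hyp))) (nf⊢ ψ γ∈ hyp))
nf⊢ (φ ⩔ ψ) α∈ d with ∈-++⁻ (nf φ) α∈
... | inj₁ β∈ = ⩔I₁ (nf⊢ φ β∈ d)
... | inj₂ γ∈ = ⩔I₂ (nf⊢ ψ γ∈ d)

infix 4 _≼[_]_
_≼[_]_ : Team → ℕ → Team → Set
r ≼[ N ] t = ∀ w → r w → ∃ λ v → t v × v ≈[ N ] w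

⊨-≼ : ∀ φ {N r t} → varBound φ ≤ N → r ≼[ N ] t → t ⊨ φ → r ⊨ φ
⊨-≼ (var p) p<N r≼t (lift h) = lift λ w rw →
  let v , tv , v≈w = r≼t w rw in trans (sym (v≈w p p<N)) (h v tv)
⊨-≼ ⊥' _ r≼t (lift h) = lift λ w rw → h _ (proj₁ (proj₂ (r≼t w rw)))
⊨-≼ (¬' φ) b r≼t h w rw w⊨φ =
  let v , tv , v≈w = r≼t w rw in
  h v tv (⊨-≼ φ b (λ u u≡v → w , (λ _ → refl) , λ n n<N → trans (sym (v≈w n n<N)) (sym (u≡v n))) w⊨φ)
⊨-≼ (φ ∧' ψ) b r≼t (hφ , hψ) =
  ⊨-≼ φ (m⊔n≤o⇒m≤o _ _ b) r≼t hφ , ⊨-≼ ψ (m⊔n≤o⇒n≤o _ _ b) r≼t hψ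
⊨-≼ (φ ∨' ψ) {N} {r} b r≼t (t₁ , t₂ , _ , _ , t=t₁∪t₂ , h₁ , h₂) =
  part t₁ , part t₂ , (λ _ → proj₁) , (λ _ → proj₁) , r=r₁∪r₂ ,
  ⊨-≼ φ (m⊔n≤o⇒m≤o _ _ b) (λ _ → proj₂) h₁ , ⊨-≼ ψ (m⊔n≤o⇒n≤o _ _ b) (λ _ → proj₂) h₂
  where
  part : Team → Team
  part s w = r w × ∃ λ v → s v × v ≈[ N ] w
  r=r₁∪r₂ : IsUnion r (part t₁) (part t₂)
  r=r₁∪r₂ w = (λ rw → let v , tv , v≈w = r≼t w rw in
                      Sum.map (λ t₁v → rw , v , t₁v , v≈w) (λ t₂v → rw , v , t₂v , v≈w)
                              (proj₁ (t=t₁∪t₂ v) tv))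
            , [ proj₁ , proj₁ ]′
⊨-≼ (φ ⩔ ψ) b r≼t = Sum.map (⊨-≼ φ (m⊔n≤o⇒m≤o _ _ b) r≼t) (⊨-≼ ψ (m⊔n≤o⇒n≤o _ _ b) r≼t)

⊨-⊆ : ∀ φ {r t} → r ⊆ t → t ⊨ φ → r ⊨ φ
⊨-⊆ φ r⊆t = ⊨-≼ φ ≤-refl λ w rw → w , r⊆t w rw , λ _ _ → refl

⊨-singleton : ∀ φ {t v} → t v → t ⊨ φ → singleton v ⊨ φ
⊨-singleton φ {v = v} tv = ⊨-≼ φ ≤-refl λ w w≡v → v , tv , λ n _ → sym (w≡v n)

⊨-empty : ∀ φ {t} → (∀ v → ¬ t v) → t ⊨ φ
⊨-empty (var p)  e = lift λ v tv → ⊥-elim (e v tv)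
⊨-empty ⊥'       e = lift e
⊨-empty (¬' φ)   e = λ v tv → ⊥-elim (e v tv)
⊨-empty (φ ∧' ψ) e = ⊨-empty φ e , ⊨-empty ψ e
⊨-empty (φ ∨' ψ) {t} e =
  t , t , (λ _ → id) , (λ _ → id) , (λ _ → inj₁ , [ id , id ]′) , ⊨-empty φ e , ⊨-empty ψ e
⊨-empty (φ ⩔ ψ)  e = inj₁ (⊨-empty φ e)

∅ : Team
∅ _ = ⊥

⊨-∨-left : ∀ {t φ} ψ → t ⊨ φ → t ⊨ φ ∨' ψ
⊨-∨-left {t} ψ h = t , ∅ , (λ _ → id) , (λ _ ()) , (λ _ → inj₁ , [ id , (λ ()) ]′) , h , ⊨-empty ψ (λ _ ())

⊨-∨-comm : ∀ {t φ ψ} → t ⊨ φ ∨' ψ → t ⊨ ψ ∨' φ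
⊨-∨-comm (t₁ , t₂ , t₁⊆t , t₂⊆t , t=t₁∪t₂ , h₁ , h₂) =
  t₂ , t₁ , t₂⊆t , t₁⊆t , (λ v → swap ∘ proj₁ (t=t₁∪t₂ v) , proj₂ (t=t₁∪t₂ v) ∘ swap) , h₂ , h₁

⊨singleton⇔eval : ∀ φ v → (singleton v ⊨ φ) ⇔ T (eval v φ)
⊨singleton⇔eval (var p) v = mk⇔ (λ h → Equivalence.from T-≡ (lower h v (λ _ → refl)))
                                (λ x → lift λ w w≡v → trans (w≡v p) (Equivalence.to T-≡ x))
⊨singleton⇔eval ⊥' v = mk⇔ (λ h → lower h v (λ _ → refl)) (λ ())
⊨singleton⇔eval (¬' φ) v with eval v φ | ⊨singleton⇔eval φ v
... | true  | ih = mk⇔ (λ h → h v (λ _ → refl) (Equivalence.from ih _)) (λ ())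
... | false | ih = mk⇔ (λ _ → _) (λ _ w w≡v w⊨φ → Equivalence.to ih (⊨-singleton φ (sym ∘ w≡v) w⊨φ))
⊨singleton⇔eval (φ ∧' ψ) v = mk⇔
  (λ (hφ , hψ) → Equivalence.from T-∧ (Equivalence.to ihφ hφ , Equivalence.to ihψ hψ))
  (λ x → let xφ , xψ = Equivalence.to (T-∧ {eval v φ}) x in Equivalence.from ihφ xφ , Equivalence.from ihψ xψ)
  where ihφ = ⊨singleton⇔eval φ v
        ihψ = ⊨singleton⇔eval ψ v
⊨singleton⇔eval (φ ∨' ψ) v = mk⇔ to from
  where
  ihφ = ⊨singleton⇔eval φ v
  ihψ = ⊨singleton⇔eval ψ v
  to : singleton v ⊨ φ ∨' ψ → T (eval v φ ∨ eval v ψ)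
  to (_ , _ , _ , _ , v=t₁∪t₂ , h₁ , h₂) = Equivalence.from T-∨
    (Sum.map (λ t₁v → Equivalence.to ihφ (⊨-singleton φ t₁v h₁))
             (λ t₂v → Equivalence.to ihψ (⊨-singleton ψ t₂v h₂))
             (proj₁ (v=t₁∪t₂ v) (λ _ → refl)))
  from : T (eval v φ ∨ eval v ψ) → singleton v ⊨ φ ∨' ψ
  from x = [ ⊨-∨-left ψ ∘ Equivalence.from ihφ , ⊨-∨-comm ∘ ⊨-∨-left φ ∘ Equivalence.from ihψ ]′
             (Equivalence.to (T-∨ {eval v φ}) x)
⊨singleton⇔eval (φ ⩔ ψ) v = mk⇔
  (Equivalence.from T-∨ ∘ Sum.map (Equivalence.to ihφ) (Equivalence.to ihψ))
  (Sum.map (Equivalence.from ihφ) (Equivalence.from ihψ) ∘ Equivalence.to (T-∨ {eval v φ}))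
  where ihφ = ⊨singleton⇔eval φ v
        ihψ = ⊨singleton⇔eval ψ v

T-not⇒¬T : ∀ {b} → T (not b) → ¬ T b
T-not⇒¬T {false} _ ()

⊨⇒eval : ∀ φ {t v} → t ⊨ φ → t v → T (eval v φ)
⊨⇒eval φ {v = v} h tv = Equivalence.to (⊨singleton⇔eval φ v) (⊨-singleton φ tv h)

eval⇒⊨ : ∀ {α} → Classical α → ∀ {t} → (∀ v → t v → T (eval v α)) → t ⊨ α
eval⇒⊨ (var p) h = lift λ v tv → Equivalence.to T-≡ (h v tv)
eval⇒⊨ ⊥'      h = lift h
eval⇒⊨ (¬'_ {α} c) h v tv v⊨α = T-not⇒¬T (h v tv) (Equivalence.to (⊨singleton⇔eval α v) v⊨α)
eval⇒⊨ (_∧'_ {α} c d) h =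
  eval⇒⊨ c (λ v → proj₁ ∘ Equivalence.to (T-∧ {eval v α}) ∘ h v) ,
  eval⇒⊨ d (λ v → proj₂ ∘ Equivalence.to (T-∧ {eval v α}) ∘ h v)
eval⇒⊨ (_∨'_ {α} {β} c d) {t} h =
  t₁ , t₂ , (λ _ → proj₁) , (λ _ → proj₁) , t=t₁∪t₂ , eval⇒⊨ c (λ _ → proj₂) , eval⇒⊨ d (λ _ → proj₂)
  where
  t₁ t₂ : Team
  t₁ v = t v × T (eval v α)
  t₂ v = t v × T (eval v β)
  t=t₁∪t₂ : IsUnion t t₁ t₂
  t=t₁∪t₂ v = (λ tv → Sum.map (tv ,_) (tv ,_) (Equivalence.to (T-∨ {eval v α}) (h v tv)))
            , [ proj₁ , proj₁ ]′

-- Soundness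

Sat : Ctx → Team → Set₁
Sat Γ t = ∀ ψ → Γ ψ → t ⊨ ψ

Sat-,, : ∀ {Γ t φ} → Sat Γ t → t ⊨ φ → Sat (Γ ,, φ) t
Sat-,, h _ _ (inj₁ γ)    = h _ γ
Sat-,, _ x _ (inj₂ refl) = x

Sat-⊆ : ∀ {Γ r t} → r ⊆ t → Sat Γ t → Sat Γ r
Sat-⊆ r⊆t h ψ γ = ⊨-⊆ ψ r⊆t (h ψ γ)

Sat-singleton : ∀ {Γ t v} → t v → Sat Γ t → Sat Γ (singleton v)
Sat-singleton tv h ψ γ = ⊨-singleton ψ tv (h ψ γ)

sound : ∀ {Γ φ} → Γ ⊢ φ → Γ ⊨ᶜ φ
sound (assm γ) t h = h _ γ
sound {φ = φ} (⊥E d) t h = ⊨-empty φ (lower (sound d t h))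
sound (∧I d e) t h = sound d t h , sound e t h
sound (∧E₁ d) t h = proj₁ (sound d t h)
sound (∧E₂ d) t h = proj₂ (sound d t h)
sound (¬I d) t h v tv v⊨φ = lower (sound d (singleton v) (Sat-,, (Sat-singleton tv h) v⊨φ)) v (λ _ → refl)
sound {φ = ψ} (¬E {φ = φ} d e) t h = ⊨-empty ψ λ v tv → sound e t h v tv (⊨-singleton φ tv (sound d t h))
sound (RAA {α = α} c d) t h = eval⇒⊨ c true-at
  where
  true-at : ∀ v → t v → T (eval v α)
  true-at v tv with eval v α | ⊨singleton⇔eval (¬' α) v
  ... | true  | _     = _
  ... | false | v⊨¬α = lower (sound d (singleton v) (Sat-,, (Sat-singleton tv h) (Equivalence.from v⊨¬α _))) v (λ _ → refl)
sound (⩔I₁ d) t h = inj₁ (sound d t h)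
sound (⩔I₂ d) t h = inj₂ (sound d t h)
sound (⩔E d e f) t h = [ (λ x → sound e t (Sat-,, h x)) , (λ y → sound f t (Sat-,, h y)) ]′ (sound d t h)
sound {φ = _ ∨' ψ} (∨I d) t h = ⊨-∨-left ψ (sound d t h)
sound (∨E {α = α} c d e f) t h with sound d t h
... | t₁ , t₂ , t₁⊆t , t₂⊆t , t=t₁∪t₂ , h₁ , h₂ = eval⇒⊨ c λ v tv →
  [ ⊨⇒eval α (sound e t₁ (Sat-,, (Sat-⊆ t₁⊆t h) h₁)) , ⊨⇒eval α (sound f t₂ (Sat-,, (Sat-⊆ t₂⊆t h) h₂)) ]′
  (proj₁ (t=t₁∪t₂ v) tv)
sound (∨Com d) t h = ⊨-∨-comm (sound d t h)
sound (∨Mon d e) t h with sound d t h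
... | t₁ , t₂ , t₁⊆t , t₂⊆t , t=t₁∪t₂ , h₁ , h₂ =
  t₁ , t₂ , t₁⊆t , t₂⊆t , t=t₁∪t₂ , sound e t₁ (Sat-,, (Sat-⊆ t₁⊆t h) h₁) , h₂
sound (Dis∨⩔ d) t h with sound d t h
... | t₁ , t₂ , t₁⊆t , t₂⊆t , t=t₁∪t₂ , h₁ , h₂ =
  Sum.map (λ h₂′ → t₁ , t₂ , t₁⊆t , t₂⊆t , t=t₁∪t₂ , h₁ , h₂′)
          (λ h₂′ → t₁ , t₂ , t₁⊆t , t₂⊆t , t=t₁∪t₂ , h₁ , h₂′) h₂

-- Compactness of B^ℕ for finite B

module FinitelyBranching
  (dne : DoubleNegationElimination (Level.suc 0ℓ))
  {B : Set} (elements : List B) (∈-elements : ∀ b → b ∈ elements)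
  {I : Set} (P : I → (ℕ → B) → Set₁) (depth : I → ℕ)
  (determined : ∀ i {s s′} → s ≈[ depth i ] s′ → P i s → P i s′)
  where

  SatisfiesAll : List I → (ℕ → B) → Set₁
  SatisfiesAll is s = ∀ {i} → i ∈ is → P i s

  Refuted : ℕ → (ℕ → B) → Set₁
  Refuted N s = ∃ λ is → ∀ s′ → s′ ≈[ N ] s → ¬ SatisfiesAll is s′

  refuted-split : ∀ {N s} → (∀ b → Refuted (suc N) (s [ N ≔ b ])) → Refuted N s
  refuted-split {N} r = concatMap (proj₁ ∘ r) elements , λ s′ s′≈s sat →
    proj₂ (r (s′ N)) s′ (≈-[≔] s′≈s)
      (λ i∈ → sat (∈-concat⁺′ i∈ (∈-map⁺ (proj₁ ∘ r) (∈-elements (s′ N)))))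

  extend : ∀ {N s} → ¬ Refuted N s → ∃ λ b → ¬ Refuted (suc N) (s [ N ≔ b ])
  extend ¬r = dne λ ¬ext → ¬r (refuted-split λ b → dne λ ¬rb → ¬ext (b , ¬rb))

  finitely-satisfiable⇒satisfiable : (∀ is → ∃ (SatisfiesAll is)) → ∃ λ s → ∀ i → P i s
  finitely-satisfiable⇒satisfiable finSat = limit , λ i → dne λ ¬Pi →
    proj₂ (branch (depth i)) ((i ∷ []) , λ s′ s′≈ sat →
      ¬Pi (determined i (≈-trans s′≈ (≈-sym (limit-≈ (depth i)))) (sat (here refl))))
    where
    branch : ∀ N → ∃ λ s → ¬ Refuted N s
    branch zero    = proj₁ (finSat []) , λ (is , r) → r _ (λ _ ()) (proj₂ (finSat is))
    branch (suc N) = proj₁ (branch N) [ N ≔ proj₁ (extend (proj₂ (branch N))) ] ,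
                     proj₂ (extend (proj₂ (branch N)))

    limit : ℕ → B
    limit n = proj₁ (branch (suc n)) n

    limit-≈ : ∀ N → limit ≈[ N ] proj₁ (branch N)
    limit-≈ (suc N) n n<1+N with m<1+n⇒m<n∨m≡n n<1+N
    ... | inj₁ n<N  = trans (limit-≈ N n n<N) (sym ([≔]-≈ _ N _ n n<N))
    ... | inj₂ refl = refl

-- Completeness for a single premise

⊨⋁⇒ : ∀ {t} αs → NonEmpty αs → t ⊨ ⋁ αs → ∃ λ α → α ∈ αs × t ⊨ α
⊨⋁⇒ (α ∷ [])     _ h        = α , here refl , h
⊨⋁⇒ (α ∷ _ ∷ _)  _ (inj₁ h) = α , here refl , h
⊨⋁⇒ (_ ∷ β ∷ αs) _ (inj₂ h) =
  let γ , γ∈ , hγ = ⊨⋁⇒ (β ∷ αs) (β , here refl) h in γ , there γ∈ , hγ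

⊨nf : ∀ φ {t} → t ⊨ φ → ∃ λ α → α ∈ nf φ × t ⊨ α
⊨nf φ {t} h = ⊨⋁⇒ (nf φ) (nf-nonEmpty φ) (sound (⊢⋁nf φ (assm {_≡ φ} refl)) t λ { _ refl → h })

nf⊨ : ∀ φ {α t} → α ∈ nf φ → t ⊨ α → t ⊨ φ
nf⊨ φ {α} α∈ h = sound (nf⊢ φ α∈ (assm {_≡ α} refl)) _ λ { _ refl → h }

entailment⇒⊢ : ∀ {Γ χ φ} → (∀ t → t ⊨ χ → t ⊨ φ) → Γ ⊢ χ → Γ ⊢ φ
entailment⇒⊢ {χ = χ} {φ} χ⊨φ d = ⋁-elim (nf χ) (⊢⋁nf χ d) λ {α} α∈ →
  let models : Team
      models v = T (eval v α)
      β , β∈ , models⊨β = ⊨nf φ (χ⊨φ models (nf⊨ χ α∈ (eval⇒⊨ (nf-classical χ α∈) λ _ → id)))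
  in nf⊢ φ β∈ (⊢-tautological (RAA (nf-classical φ β∈)) (λ _ → ⊨⇒eval β models⊨β) hyp)

⋀ : List Form → Form
⋀ []       = ¬' ⊥'
⋀ (γ ∷ γs) = γ ∧' ⋀ γs

⊢⋀ : ∀ {Γ γs} → All (Γ ⊢_) γs → Γ ⊢ ⋀ γs
⊢⋀ []       = ¬I hyp
⊢⋀ (d ∷ ds) = ∧I d (⊢⋀ ds)

⊨⋀⇒ : ∀ {t γ} γs → t ⊨ ⋀ γs → γ ∈ γs → t ⊨ γ
⊨⋀⇒ (_ ∷ _)  (h , _) (here refl) = h
⊨⋀⇒ (_ ∷ γs) (_ , h) (there γ∈) = ⊨⋀⇒ γs h γ∈

-- Compactness

vectors : ∀ m → List (Vec Bool m)
vectors zero    = [] ∷ []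
vectors (suc m) = cartesianProductWith _∷_ (true ∷ false ∷ []) (vectors m)

∈-vectors : ∀ {m} (bs : Vec Bool m) → bs ∈ vectors m
∈-vectors []           = here refl
∈-vectors (true ∷ bs)  = ∈-cartesianProductWith⁺ _∷_ {xs = true ∷ false ∷ []} (here refl) (∈-vectors bs)
∈-vectors (false ∷ bs) = ∈-cartesianProductWith⁺ _∷_ {xs = true ∷ false ∷ []} (there (here refl)) (∈-vectors bs)

⟪_⟫ : ∀ {m} → (Fin m → Valuation) → Team
⟪ ws ⟫ u = ∃ λ k → ∀ n → u n ≡ ws k n

⟪⟫-≼ : ∀ {m N} {ws ws′ : Fin m → Valuation} → (∀ k → ws k ≈[ N ] ws′ k) → ⟪ ws′ ⟫ ≼[ N ] ⟪ ws ⟫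
⟪⟫-≼ {ws = ws} ws≈ws′ u (k , u≡) = ws k , (k , λ _ → refl) , λ n n<N → trans (ws≈ws′ k n n<N) (sym (u≡ n))

columns : ∀ {m} → (ℕ → Vec Bool m) → Fin m → Valuation
columns s k n = Vec.lookup (s n) k

rows : ∀ {m} → (Fin m → Valuation) → ℕ → Vec Bool m
rows ws n = tabulate λ k → ws k n

columns-≈ : ∀ {m N} {s s′ : ℕ → Vec Bool m} → s ≈[ N ] s′ → ∀ k → columns s k ≈[ N ] columns s′ k
columns-≈ s≈s′ k n n<N = cong (λ bs → Vec.lookup bs k) (s≈s′ n n<N)

columns-rows : ∀ {m N} (ws : Fin m → Valuation) k → columns (rows ws) k ≈[ N ] ws k
columns-rows ws k n _ = lookup∘tabulate (λ k → ws k n) k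

FiniteEntailment : Ctx → Form → Set₁
FiniteEntailment Γ φ = ∃ λ γs → All Γ γs × (∀ t → t ⊨ ⋀ γs → t ⊨ φ)

module Constraints (Γ : Ctx) (φ : Form) where

  m : ℕ
  m = length (nf φ)

  Constraint : Set
  Constraint = Maybe (Σ Form Γ)

  Holds : Constraint → (ℕ → Vec Bool m) → Set₁
  Holds nothing        s = ¬ (⟪ columns s ⟫ ⊨ φ)
  Holds (just (γ , _)) s = ⟪ columns s ⟫ ⊨ γ

  depth : Constraint → ℕ
  depth nothing        = varBound φ
  depth (just (γ , _)) = varBound γ

  determined : ∀ c {s s′} → s ≈[ depth c ] s′ → Holds c s → Holds c s′
  determined nothing        s≈s′ s⊭φ = s⊭φ ∘ ⊨-≼ φ ≤-refl (⟪⟫-≼ (columns-≈ (≈-sym s≈s′)))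
  determined (just (γ , _)) s≈s′     = ⊨-≼ γ ≤-refl (⟪⟫-≼ (columns-≈ s≈s′))

  formulas : List Constraint → List Form
  formulas []                  = []
  formulas (nothing ∷ cs)      = formulas cs
  formulas (just (γ , _) ∷ cs) = γ ∷ formulas cs

  formulas-Γ : ∀ cs → All Γ (formulas cs)
  formulas-Γ []                  = []
  formulas-Γ (nothing ∷ cs)      = formulas-Γ cs
  formulas-Γ (just (_ , g) ∷ cs) = g ∷ formulas-Γ cs

  ∈-formulas : ∀ {cs γ g} → just (γ , g) ∈ cs → γ ∈ formulas cs
  ∈-formulas {just _ ∷ _}  (here refl) = here refl
  ∈-formulas {just _ ∷ _}  (there c∈)  = there (∈-formulas c∈)
  ∈-formulas {nothing ∷ _} (there c∈)  = ∈-formulas c∈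

  holds-rows : ∀ {cs ws} → ⟪ ws ⟫ ⊨ ⋀ (formulas cs) → ¬ (⟪ ws ⟫ ⊨ φ) →
               ∀ {c} → c ∈ cs → Holds c (rows ws)
  holds-rows {ws = ws} _ ws⊭φ {nothing} _ = ws⊭φ ∘ ⊨-≼ φ ≤-refl (⟪⟫-≼ (columns-rows ws))
  holds-rows {cs} {ws} ws⊨ _ {just _} c∈ =
    ⊨-≼ _ ≤-refl (⟪⟫-≼ (≈-sym ∘ columns-rows ws)) (⊨⋀⇒ (formulas cs) ws⊨ (∈-formulas c∈))


module _ (dne : DoubleNegationElimination (Level.suc 0ℓ)) where

  dne₀ : DoubleNegationElimination 0ℓ
  dne₀ ¬¬p = lower (dne λ ¬p → ¬¬p (¬p ∘ lift))

  countermodel : ∀ {χ φ} →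
                 ¬ (∀ t → t ⊨ χ → t ⊨ φ) → ∃ λ t → t ⊨ χ × ¬ (t ⊨ φ)
  countermodel ¬χ⊨φ = dne λ none → ¬χ⊨φ λ t h → dne λ ¬φ → none (t , h , ¬φ)

  small-countermodel : ∀ {χ φ t} → t ⊨ χ → ¬ (t ⊨ φ) →
                       ∃ λ (ws : Fin (length (nf φ)) → Valuation) → ⟪ ws ⟫ ⊨ χ × ¬ (⟪ ws ⟫ ⊨ φ)
  small-countermodel {χ} {φ} {t} t⊨χ t⊭φ = ws , ⊨-≼ χ ≤-refl ws≼t t⊨χ , ws⊭φ
    where
    falsifier : ∀ k → ∃ λ v → t v × ¬ T (eval v (lookup (nf φ) k))
    falsifier k = dne₀ λ none → t⊭φ (nf⊨ φ (∈-lookup k)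
      (eval⇒⊨ (nf-classical φ (∈-lookup k)) λ v tv → dne₀ λ ¬T → none (v , tv , ¬T)))
    ws : Fin (length (nf φ)) → Valuation
    ws k = proj₁ (falsifier k)
    ws≼t : ∀ {N} → ⟪ ws ⟫ ≼[ N ] t
    ws≼t u (k , u≡) = ws k , proj₁ (proj₂ (falsifier k)) , λ n _ → sym (u≡ n)
    ws⊭φ : ¬ (⟪ ws ⟫ ⊨ φ)
    ws⊭φ ws⊨φ =
      let β , β∈ , ws⊨β = ⊨nf φ ws⊨φ
          k = index β∈
      in proj₂ (proj₂ (falsifier k))
           (subst (λ α → T (eval (ws k) α)) (lookup-index β∈) (⊨⇒eval β ws⊨β (k , λ _ → refl)))

  compactness : ∀ {Γ φ} → Γ ⊨ᶜ φ → FiniteEntailment Γ φ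
  compactness {Γ} {φ} Γ⊨φ = dne λ no-finite →
    let s , holds = FinitelyBranching.finitely-satisfiable⇒satisfiable dne (vectors m) ∈-vectors
                      Holds depth determined λ cs →
          let t , t⊨ , t⊭φ = countermodel λ ⋀⊨φ → no-finite (formulas cs , formulas-Γ cs , ⋀⊨φ)
              ws , ws⊨ , ws⊭φ = small-countermodel t⊨ t⊭φ
          in rows ws , holds-rows ws⊨ ws⊭φ
    in holds nothing (Γ⊨φ ⟪ columns s ⟫ λ γ g → holds (just (γ , g)))
    where open Constraints Γ φ

completeness : ExcludedMiddle (Level.suc 0ℓ) → ∀ {Γ φ} → Γ ⊨ᶜ φ → Γ ⊢ φ
completeness em Γ⊨φ =
  let γs , γs⊆Γ , ⋀γs⊨φ = compactness (em⇒dne em) Γ⊨φ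
  in entailment⇒⊢ ⋀γs⊨φ (⊢⋀ (All.map assm γs⊆Γ))

mainTheorem10 : ExcludedMiddle (Level.suc 0ℓ) →
    (Γ : Ctx) (φ : Form) → ((Γ ⊨ᶜ φ) → (Γ ⊢ φ)) × ((Γ ⊢ φ) → (Γ ⊨ᶜ φ))
mainTheorem10 em Γ φ = completeness em , sound
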